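{- Let $d\ge3$, $h\ge1$. For each non-leaf vertex $i$ of $\mathcal{T}(d,h)$ choose a child $m_i$ and put $J_i=C_i\setminus\{m_i\}$. Define $F(d,h)=\{0\}\cup\bigcup_{q=0}^{(h-2)/2}\bigcup_{i\in S_{2q+1}}J_i$ if $h$ is even, and $F(d,h)=\bigcup_{q=0}^{(h-1)/2}\bigcup_{i\in S_{2q}}J_i$ if $h$ is odd. Then the elements $\{\bar{\mathbf{x}}_i : i\in F(d,h)\}$ generate the sandpile group $G(d,h)$.
   Context: Let $\mathcal{T}(d,h)$ be the ball of radius $h$ about a root vertex $0$ in the infinite $d$-regular tree (root has $d$ children, vertices at depth $1,\dots,h-1$ have $d-1$ children, depth-$h$ vertices are leaves; depth is the distance from $0$). $S_n$ is the set of vertices at depth $n$. Let $V$ be its vertex set, $p(i)$ the parent of $i\neq 0$, $C_i$ the children of $i$, $\{\mathbf{x}_i\}$ the standard basis of $\mathbb{Z}^V$, and $\delta_i = d\mathbf{x}_i - \mathbf{x}_{p(i)} - \sum_{j\in C_i}\mathbf{x}_j$ (omit $\mathbf{x}_{p(i)}$ for $i=0$; empty sum for leaves). The sandpile group is $G(d,h)=\mathbb{Z}^V/\sum_{i\in V}\mathbb{Z}\delta_i$, and $\bar{\mathbf{v}}$ denotes the image of $\mathbf{v}\in\mathbb{Z}^V$. -}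

module Defs where

open import Data.Nat using (ℕ; zero; suc; _∸_; _≡ᵇ_)
open import Data.Bool using (Bool; true; false; _∧_; not; if_then_else_)
open import Data.Fin using (Fin; toℕ)
open import Data.List using (List; []; _∷_; map; concatMap; foldr)
open import Data.List using () renaming (allFin to allFinL)
open import Data.Integer using (ℤ; +_; _+_; _-_; _*_; 0ℤ)
open import Data.Product using (Σ; _,_; ∃)
open import Relation.Binary.PropositionalEquality using (_≡_)

-- Number of children of a vertex at depth n in T(d,h) (if it is not a leaf):
-- the root has d children, every other non-leaf vertex has d-1 children.
arity : ℕ → ℕ → ℕ
arity d zero    = d
arity d (suc _) = d ∸ 1

-- Vertices at depth n of the infinite d-regular tree, as paths from the root.
-- 'child u b' is the b-th child of u.
data Vtx (d : ℕ) : ℕ → Set where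
  root  : Vtx d zero
  child : ∀ {n} → Vtx d n → Fin (arity d n) → Vtx d (suc n)

V : ℕ → ℕ → Set
V d h = Σ (Fin (suc h)) (λ n → Vtx d (toℕ n))

eqVtx : ∀ {d m n} → Vtx d m → Vtx d n → Bool
eqVtx root        root        = true
eqVtx root        (child _ _) = false
eqVtx (child _ _) root        = false
eqVtx (child u a) (child w b) = eqVtx u w ∧ (toℕ a ≡ᵇ toℕ b)

eqV : ∀ {d h} → V d h → V d h → Bool
eqV (_ , u) (_ , w) = eqVtx u w

-- isParent a b : a is the parent p(b) of b.
isParentVtx : ∀ {d m n} → Vtx d m → Vtx d n → Bool
isParentVtx a root        = false
isParentVtx a (child u _) = eqVtx a u

isParent : ∀ {d h} → V d h → V d h → Bool
isParent (_ , a) (_ , b) = isParentVtx a b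

allVtx : (d n : ℕ) → List (Vtx d n)
allVtx d zero    = root ∷ []
allVtx d (suc n) = concatMap (λ u → map (child u) (allFinL (arity d n))) (allVtx d n)

allV : (d h : ℕ) → List (V d h)
allV d h = concatMap (λ n → map (λ u → (n , u)) (allVtx d (toℕ n))) (allFinL (suc h))

sumV : ∀ d h → (V d h → ℤ) → ℤ
sumV d h f = foldr _+_ 0ℤ (map f (allV d h))

[_] : Bool → ℤ
[ b ] = if b then + 1 else 0ℤ

x : ∀ {d h} → V d h → V d h → ℤ
x i j = [ eqV i j ]

-- δ_i = d x_i - x_{p(i)} - Σ_{j ∈ C_i} x_j   (as an element of ℤ^V, evaluated at j).
δ : ∀ {d h} → V d h → V d h → ℤ
δ {d} i j = (+ d) * [ eqV i j ] - [ isParent j i ] - [ isParent i j ]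

InLattice : ∀ d h → (V d h → ℤ) → Set
InLattice d h w = ∃ λ (c : V d h → ℤ) → ∀ j → w j ≡ sumV d h (λ i → c i * δ i j)

-- A subset A ⊆ V (given by its indicator) generates G(d,h) = ℤ^V / Σ ℤ δ_i:
-- every v̄ equals the image of Σ_{i ∈ A} a_i x_i for some integers a_i.
Generates : ∀ d h → (V d h → Bool) → Set
Generates d h A = ∀ (v : V d h → ℤ) → ∃ λ (a : V d h → ℤ) →
  InLattice d h (λ j → v j - sumV d h (λ i → [ A i ] * (a i * x i j)))

isEven : ℕ → Bool
isEven zero          = true
isEven (suc zero)    = false
isEven (suc (suc n)) = isEven n

-- A choice of child m_i for every vertex i (only used at non-leaf vertices).
Choice : ℕ → Set
Choice d = ∀ {n} → Vtx d n → Fin (arity d n)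

-- j ∈ J_i  iff  j = child i b with b ≠ m_i.
-- F(d,h): if h even, {0} ∪ ⋃_{i at odd depth} J_i (odd depths 1,3,…,h-1);
--         if h odd,  ⋃_{i at even depth} J_i (even depths 0,2,…,h-1).
-- (Depth-h vertices are leaves, so the depth bound is automatic.)
inFVtx : ∀ {d} → ℕ → Choice d → ∀ {n} → Vtx d n → Bool
inFVtx h m root = isEven h
inFVtx h m (child {k} i b) =
  (if isEven h then not (isEven k) else isEven k) ∧ not (toℕ b ≡ᵇ toℕ (m i))

inF : ∀ {d h} → Choice d → V d h → Bool
inF {h = h} m (_ , u) = inFVtx h m u

-- Work in the subgroup of ℤ^V spanned by the δ_i and the x_i, i ∈ F; every x_u has to be
-- reached. The toppling relation δ_u = d x_u − x_{p(u)} − Σ_{c ∈ C_u} x_c lets one solve for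
-- any single term once the others are known. If the height h − k left below a vertex u of
-- depth k is odd, the children of u other than m_u lie in F; using one of them, a, the relation
-- at a yields x_u from x_a and the children of a, which have odd height again (or there are none).
-- So all vertices of odd remaining height are reached. A vertex of even remaining height is
-- either the root (in F when h is even), a child not chosen by its parent (in F), or the chosen
-- child m_v, which the relation at v yields from x_v, x_{p(v)} and the other children of v.
module Submission where

open import Defs
open import Data.Nat using (ℕ; zero; suc; _≤_; z≤n; s≤s; _≡ᵇ_) renaming (_+_ to _+ℕ_)
import Data.Nat.Properties as ℕP
open import Data.Nat.Tactic.RingSolver using () renaming (solve-∀ to ℕ-solve-∀)
open import Data.Bool using (Bool; true; false; _∧_; not; if_then_else_)
open import Data.Bool.Properties using (T-≡)
open import Data.Fin using (Fin; toℕ; fromℕ<) renaming (zero to fz; suc to fs)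
import Data.Fin.Properties as FinP
open import Data.List using (List; []; _∷_; map; concatMap; foldr; _++_)
open import Data.List using () renaming (allFin to allFinL)
open import Data.List.Properties using (map-tabulate)
open import Data.Integer using (ℤ; +_; _+_; _-_; _*_; 0ℤ; -1ℤ)
import Data.Integer.Properties as ℤP
open import Data.Integer.Tactic.RingSolver using (solve-∀)
open import Data.Product using (Σ; _,_; ∃; proj₁; proj₂; _×_)
open import Data.Sum using (_⊎_; inj₁; inj₂)
open import Data.Empty using (⊥-elim)
open import Function using (id; _∘_)
open import Function.Bundles using (Equivalence)
open import Algebra.Properties.CommutativeSemigroup ℤP.+-commutativeSemigroup
  using () renaming (interchange to +-interchange)
open import Algebra.Properties.CommutativeSemigroup ℤP.*-commutativeSemigroup
  using () renaming (x∙yz≈y∙xz to x*yz≡y*xz)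
open import Relation.Binary.PropositionalEquality
  using (_≡_; _≢_; refl; sym; trans; cong; cong₂; subst; module ≡-Reasoning)

open ≡-Reasoning

sumL : ∀ {A : Set} → List A → (A → ℤ) → ℤ
sumL L f = foldr _+_ 0ℤ (map f L)

sumL-cong : ∀ {A : Set} (L : List A) {f g : A → ℤ} → (∀ i → f i ≡ g i) → sumL L f ≡ sumL L g
sumL-cong []      e = refl
sumL-cong (a ∷ L) e = cong₂ _+_ (e a) (sumL-cong L e)

sumL-zero : ∀ {A : Set} (L : List A) → sumL L (λ _ → 0ℤ) ≡ 0ℤ
sumL-zero []      = refl
sumL-zero (a ∷ L) = trans (ℤP.+-identityˡ _) (sumL-zero L)

sumL-distrib-+ : ∀ {A : Set} (L : List A) (f g : A → ℤ) →
                 sumL L (λ i → f i + g i) ≡ sumL L f + sumL L g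
sumL-distrib-+ []      f g = refl
sumL-distrib-+ (a ∷ L) f g =
  trans (cong (_+_ (f a + g a)) (sumL-distrib-+ L f g)) (+-interchange (f a) (g a) (sumL L f) (sumL L g))

sumL-*-distribˡ : ∀ {A : Set} (L : List A) (k : ℤ) (f : A → ℤ) →
                  sumL L (λ i → k * f i) ≡ k * sumL L f
sumL-*-distribˡ []      k f = sym (ℤP.*-zeroʳ k)
sumL-*-distribˡ (a ∷ L) k f =
  trans (cong (_+_ (k * f a)) (sumL-*-distribˡ L k f)) (sym (ℤP.*-distribˡ-+ k (f a) (sumL L f)))

sumL-++ : ∀ {A : Set} (L M : List A) (f : A → ℤ) → sumL (L ++ M) f ≡ sumL L f + sumL M f
sumL-++ []      M f = sym (ℤP.+-identityˡ _)
sumL-++ (a ∷ L) M f = trans (cong (_+_ (f a)) (sumL-++ L M f)) (sym (ℤP.+-assoc (f a) _ _))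

sumL-map : ∀ {A B : Set} (φ : A → B) (L : List A) (f : B → ℤ) → sumL (map φ L) f ≡ sumL L (f ∘ φ)
sumL-map φ []      f = refl
sumL-map φ (a ∷ L) f = cong (_+_ (f (φ a))) (sumL-map φ L f)

sumL-concatMap : ∀ {A B : Set} (φ : A → List B) (L : List A) (f : B → ℤ) →
                 sumL (concatMap φ L) f ≡ sumL L (λ a → sumL (φ a) f)
sumL-concatMap φ []      f = refl
sumL-concatMap φ (a ∷ L) f =
  trans (sumL-++ (φ a) (concatMap φ L) f) (cong (_+_ (sumL (φ a) f)) (sumL-concatMap φ L f))

sumL-allFin-suc : ∀ k (F : Fin (suc k) → ℤ) → sumL (allFinL (suc k)) F ≡ F fz + sumL (allFinL k) (F ∘ fs)
sumL-allFin-suc k F =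
  cong (_+_ (F fz)) (trans (cong (λ L → sumL L F) (sym (map-tabulate id fs))) (sumL-map fs (allFinL k) F))

sumL-allFin-point : ∀ k (F : Fin k → ℤ) (c₀ : Fin k) → (∀ c → c ≢ c₀ → F c ≡ 0ℤ) →
                    sumL (allFinL k) F ≡ F c₀
sumL-allFin-point (suc k) F fz vanish = begin
  sumL (allFinL (suc k)) F                  ≡⟨ sumL-allFin-suc k F ⟩
  F fz + sumL (allFinL k) (F ∘ fs)          ≡⟨ cong (_+_ (F fz)) (sumL-cong (allFinL k) (λ c → vanish (fs c) (λ ()))) ⟩
  F fz + sumL (allFinL k) (λ _ → 0ℤ)        ≡⟨ cong (_+_ (F fz)) (sumL-zero (allFinL k)) ⟩
  F fz + 0ℤ                                 ≡⟨ ℤP.+-identityʳ (F fz) ⟩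
  F fz                                      ∎
sumL-allFin-point (suc k) F (fs c₀) vanish = begin
  sumL (allFinL (suc k)) F                  ≡⟨ sumL-allFin-suc k F ⟩
  F fz + sumL (allFinL k) (F ∘ fs)          ≡⟨ cong (_+ sumL (allFinL k) (F ∘ fs)) (vanish fz (λ ())) ⟩
  0ℤ + sumL (allFinL k) (F ∘ fs)            ≡⟨ ℤP.+-identityˡ _ ⟩
  sumL (allFinL k) (F ∘ fs)
    ≡⟨ sumL-allFin-point k (F ∘ fs) c₀ (λ c c≢c₀ → vanish (fs c) (c≢c₀ ∘ FinP.suc-injective)) ⟩
  F (fs c₀)                                 ∎

≡ᵇ-refl : ∀ n → (n ≡ᵇ n) ≡ true
≡ᵇ-refl n = Equivalence.to T-≡ (ℕP.≡⇒≡ᵇ n n refl)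

≡ᵇ-sym : ∀ a b → (a ≡ᵇ b) ≡ (b ≡ᵇ a)
≡ᵇ-sym zero    zero    = refl
≡ᵇ-sym zero    (suc b) = refl
≡ᵇ-sym (suc a) zero    = refl
≡ᵇ-sym (suc a) (suc b) = ≡ᵇ-sym a b

toℕ-≡ᵇ⇒≡ : ∀ {k} (a b : Fin k) → (toℕ a ≡ᵇ toℕ b) ≡ true → a ≡ b
toℕ-≡ᵇ⇒≡ a b e = FinP.toℕ-injective (ℕP.≡ᵇ⇒≡ (toℕ a) (toℕ b) (Equivalence.from T-≡ e))

toℕ-≢⇒≡ᵇ-false : ∀ {k} (a b : Fin k) → a ≢ b → (toℕ a ≡ᵇ toℕ b) ≡ false
toℕ-≢⇒≡ᵇ-false a b a≢b with toℕ a ≡ᵇ toℕ b in e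
... | true  = ⊥-elim (a≢b (toℕ-≡ᵇ⇒≡ a b e))
... | false = refl

sumL-allFin-indicator : ∀ k (F : Fin k → ℤ) (c₀ : Fin k) →
                        sumL (allFinL k) (λ c → F c * [ toℕ c ≡ᵇ toℕ c₀ ]) ≡ F c₀
sumL-allFin-indicator k F c₀ =
  trans (sumL-allFin-point k _ c₀ vanish)
        (trans (cong (λ b → F c₀ * [ b ]) (≡ᵇ-refl (toℕ c₀))) (ℤP.*-identityʳ (F c₀)))
  where
  vanish : ∀ c → c ≢ c₀ → F c * [ toℕ c ≡ᵇ toℕ c₀ ] ≡ 0ℤ
  vanish c c≢ = trans (cong (λ b → F c * [ b ]) (toℕ-≢⇒≡ᵇ-false c c₀ c≢)) (ℤP.*-zeroʳ (F c))

sumL-allFin-split : ∀ k (F : Fin k → ℤ) (c₀ : Fin k) →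
  sumL (allFinL k) F ≡ F c₀ + sumL (allFinL k) (λ c → [ not (toℕ c ≡ᵇ toℕ c₀) ] * F c)
sumL-allFin-split k F c₀ = begin
  sumL (allFinL k) F
    ≡⟨ sumL-cong (allFinL k) split ⟩
  sumL (allFinL k) (λ c → F c * [ toℕ c ≡ᵇ toℕ c₀ ] + other c)
    ≡⟨ sumL-distrib-+ (allFinL k) _ other ⟩
  sumL (allFinL k) (λ c → F c * [ toℕ c ≡ᵇ toℕ c₀ ]) + sumL (allFinL k) other
    ≡⟨ cong (_+ sumL (allFinL k) other) (sumL-allFin-indicator k F c₀) ⟩
  F c₀ + sumL (allFinL k) other
    ∎
  where
  other : Fin k → ℤ
  other c = [ not (toℕ c ≡ᵇ toℕ c₀) ] * F c
  take : ∀ a → a ≡ a * + 1 + 0ℤ * a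
  take = solve-∀
  leave : ∀ a → a ≡ a * 0ℤ + + 1 * a
  leave = solve-∀
  split : ∀ c → F c ≡ F c * [ toℕ c ≡ᵇ toℕ c₀ ] + other c
  split c with toℕ c ≡ᵇ toℕ c₀
  ... | true  = take (F c)
  ... | false = leave (F c)

eqVtx-refl : ∀ {d n} (u : Vtx d n) → eqVtx u u ≡ true
eqVtx-refl root        = refl
eqVtx-refl (child u a) rewrite eqVtx-refl u | ≡ᵇ-refl (toℕ a) = refl

eqVtx-sym : ∀ {d m n} (u : Vtx d m) (w : Vtx d n) → eqVtx u w ≡ eqVtx w u
eqVtx-sym root        root        = refl
eqVtx-sym root        (child w b) = refl
eqVtx-sym (child u a) root        = refl
eqVtx-sym (child u a) (child w b) rewrite eqVtx-sym u w | ≡ᵇ-sym (toℕ a) (toℕ b) = refl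

eqVtx⇒depth-≡ : ∀ {d m n} (u : Vtx d m) (w : Vtx d n) → eqVtx u w ≡ true → m ≡ n
eqVtx⇒depth-≡ root        root        e = refl
eqVtx⇒depth-≡ (child u a) (child w b) e with eqVtx u w in e′
... | true = cong suc (eqVtx⇒depth-≡ u w e′)

depth-≢⇒eqVtx-false : ∀ {d m n} (u : Vtx d m) (w : Vtx d n) → m ≢ n → eqVtx u w ≡ false
depth-≢⇒eqVtx-false u w m≢n with eqVtx u w in e
... | true  = ⊥-elim (m≢n (eqVtx⇒depth-≡ u w e))
... | false = refl

isParentVtx-shallower : ∀ {d m n} (u : Vtx d m) (w : Vtx d n) → n ≤ m → isParentVtx u w ≡ false
isParentVtx-shallower u root        n≤m = refl
isParentVtx-shallower u (child {n} w c) n≤m with eqVtx u w in e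
... | true  = ⊥-elim (ℕP.n≮n n (subst (suc n ≤_) (eqVtx⇒depth-≡ u w e) n≤m))
... | false = refl

depth≤h : ∀ {d h} (i : V d h) → toℕ (proj₁ i) ≤ h
depth≤h i = ℕP.≤-pred (FinP.toℕ<n (proj₁ i))

arity≥2 : ∀ {d} → 3 ≤ d → ∀ n → 2 ≤ arity d n
arity≥2 d≥3 zero    = ℕP.≤-trans (ℕP.n≤1+n 2) d≥3
arity≥2 d≥3 (suc n) = ℕP.∸-monoˡ-≤ 1 d≥3

anotherFin : ∀ {k} → 2 ≤ k → (c : Fin k) → Σ (Fin k) λ b → (toℕ b ≡ᵇ toℕ c) ≡ false
anotherFin (s≤s (s≤s _)) fz     = fs fz , refl
anotherFin (s≤s (s≤s _)) (fs c) = fz , refl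

isParentVtx-sum : ∀ {d m n} (u : Vtx d m) (w : Vtx d n) →
                  [ isParentVtx u w ] ≡ sumL (allFinL (arity d m)) (λ b → [ eqVtx (child u b) w ])
isParentVtx-sum {d} {m} u root = sym (sumL-zero (allFinL (arity d m)))
isParentVtx-sum {d} {m} u (child w c) with eqVtx u w in e
... | true  = sym (countChild (eqVtx⇒depth-≡ u w e) c)
  where
  countChild : ∀ {n′} → m ≡ n′ → (c : Fin (arity d n′)) →
               sumL (allFinL (arity d m)) (λ b → [ toℕ b ≡ᵇ toℕ c ]) ≡ + 1
  countChild refl c = trans (sumL-cong (allFinL (arity d m)) (λ b → sym (ℤP.*-identityˡ [ toℕ b ≡ᵇ toℕ c ])))
                            (sumL-allFin-indicator (arity d m) (λ _ → + 1) c)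
... | false = sym (sumL-zero (allFinL (arity d m)))

sumL-allVtx-indicator : ∀ {d} n (w : Vtx d n) (g : Vtx d n → ℤ) →
                        sumL (allVtx d n) (λ u → g u * [ eqVtx u w ]) ≡ g w
sumL-allVtx-indicator zero    root        g = trans (ℤP.+-identityʳ (g root * + 1)) (ℤP.*-identityʳ (g root))
sumL-allVtx-indicator {d} (suc n) (child w c) g = begin
  sumL (allVtx d (suc n)) (λ v → g v * [ eqVtx v (child w c) ])
    ≡⟨ sumL-concatMap (λ u → map (child u) (allFinL (arity d n))) (allVtx d n) _ ⟩
  sumL (allVtx d n) (λ u → sumL (map (child u) (allFinL (arity d n))) (λ v → g v * [ eqVtx v (child w c) ]))
    ≡⟨ sumL-cong (allVtx d n) (λ u → trans (sumL-map (child u) (allFinL (arity d n)) _) (factor u)) ⟩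
  sumL (allVtx d n) (λ u → G u * [ eqVtx u w ])
    ≡⟨ sumL-allVtx-indicator n w G ⟩
  G w
    ≡⟨ sumL-allFin-indicator (arity d n) (λ b → g (child w b)) c ⟩
  g (child w c)
    ∎
  where
  G : Vtx d n → ℤ
  G u = sumL (allFinL (arity d n)) (λ b → g (child u b) * [ toℕ b ≡ᵇ toℕ c ])
  factor : ∀ u → sumL (allFinL (arity d n)) (λ b → g (child u b) * [ eqVtx u w ∧ (toℕ b ≡ᵇ toℕ c) ])
                 ≡ G u * [ eqVtx u w ]
  factor u with eqVtx u w
  ... | true  = sym (ℤP.*-identityʳ (G u))
  ... | false = trans (sumL-cong (allFinL (arity d n)) (λ b → ℤP.*-zeroʳ (g (child u b))))
                      (trans (sumL-zero (allFinL (arity d n))) (sym (ℤP.*-zeroʳ (G u))))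

sumV-indicator : ∀ d h (i : V d h) (g : V d h → ℤ) → sumV d h (λ k → g k * [ eqV k i ]) ≡ g i
sumV-indicator d h (n₀ , w) g = begin
  sumV d h term
    ≡⟨ sumL-concatMap (λ n → map (n ,_) (allVtx d (toℕ n))) (allFinL (suc h)) term ⟩
  sumL (allFinL (suc h)) (λ n → sumL (map (n ,_) (allVtx d (toℕ n))) term)
    ≡⟨ sumL-cong (allFinL (suc h)) (λ n → sumL-map (n ,_) (allVtx d (toℕ n)) term) ⟩
  sumL (allFinL (suc h)) atDepth
    ≡⟨ sumL-allFin-point (suc h) atDepth n₀ otherDepths ⟩
  atDepth n₀
    ≡⟨ sumL-allVtx-indicator (toℕ n₀) w (λ u → g (n₀ , u)) ⟩
  g (n₀ , w)
    ∎
  where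
  term : V d h → ℤ
  term k = g k * [ eqV k (n₀ , w) ]
  atDepth : Fin (suc h) → ℤ
  atDepth n = sumL (allVtx d (toℕ n)) (λ u → g (n , u) * [ eqVtx u w ])
  otherDepths : ∀ n → n ≢ n₀ → atDepth n ≡ 0ℤ
  otherDepths n n≢ = trans (sumL-cong (allVtx d (toℕ n)) (λ u → trans
      (cong (λ b → g (n , u) * [ b ]) (depth-≢⇒eqVtx-false u w (n≢ ∘ FinP.toℕ-injective)))
      (ℤP.*-zeroʳ (g (n , u)))))
    (sumL-zero (allVtx d (toℕ n)))

isEven-double : ∀ t → isEven (t +ℕ t) ≡ true
isEven-double zero    = refl
isEven-double (suc t) rewrite ℕP.+-suc t t = isEven-double t

isEven-suc-double : ∀ t → isEven (suc (t +ℕ t)) ≡ false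
isEven-suc-double zero    = refl
isEven-suc-double (suc t) rewrite ℕP.+-suc t t = isEven-suc-double t

even⊎odd : ∀ n → (∃ λ t → n ≡ t +ℕ t) ⊎ (∃ λ t → n ≡ suc (t +ℕ t))
even⊎odd zero = inj₁ (0 , refl)
even⊎odd (suc n) with even⊎odd n
... | inj₁ (t , n≡) = inj₂ (t , cong suc n≡)
... | inj₂ (t , n≡) = inj₁ (suc t , cong suc (trans n≡ (sym (ℕP.+-suc t t))))

-- The parity test in inFVtx (child u b) when u has depth k and height h − k = 2t + 1 below it.
oddHeight-depthCondition : ∀ k t → (if isEven (k +ℕ suc (t +ℕ t)) then not (isEven k) else isEven k) ≡ true
oddHeight-depthCondition zero          t rewrite isEven-suc-double t = refl
oddHeight-depthCondition (suc zero)    t rewrite isEven-double t     = refl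
oddHeight-depthCondition (suc (suc k)) t = oddHeight-depthCondition k t

module LinearSpan {I J : Set} (L : List I) (g : I → J → ℤ) where

  combination : (I → ℤ) → J → ℤ
  combination a j = sumL L (λ i → a i * g i j)

  InSpan : (J → ℤ) → Set
  InSpan w = ∃ λ a → ∀ j → w j ≡ combination a j

  span-cong : ∀ {w w′} → (∀ j → w j ≡ w′ j) → InSpan w → InSpan w′
  span-cong e (a , p) = a , λ j → trans (sym (e j)) (p j)

  span-zero : InSpan (λ _ → 0ℤ)
  span-zero = (λ _ → 0ℤ) , λ j → sym (trans (sumL-cong L (λ i → ℤP.*-zeroˡ (g i j))) (sumL-zero L))

  span-+ : ∀ {w w′} → InSpan w → InSpan w′ → InSpan (λ j → w j + w′ j)
  span-+ {w} {w′} (a , p) (b , q) = (λ i → a i + b i) , λ j → begin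
    w j + w′ j                                   ≡⟨ cong₂ _+_ (p j) (q j) ⟩
    combination a j + combination b j            ≡⟨ sumL-distrib-+ L _ _ ⟨
    sumL L (λ i → a i * g i j + b i * g i j)     ≡⟨ sumL-cong L (λ i → ℤP.*-distribʳ-+ (g i j) (a i) (b i)) ⟨
    combination (λ i → a i + b i) j              ∎

  span-scale : ∀ {w} (k : ℤ) → InSpan w → InSpan (λ j → k * w j)
  span-scale {w} k (a , p) = (λ i → k * a i) , λ j → begin
    k * w j                                      ≡⟨ cong (k *_) (p j) ⟩
    k * combination a j                          ≡⟨ sumL-*-distribˡ L k _ ⟨
    sumL L (λ i → k * (a i * g i j))             ≡⟨ sumL-cong L (λ i → ℤP.*-assoc k (a i) (g i j)) ⟨
    combination (λ i → k * a i) j                ∎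

  span-- : ∀ {w w′} → InSpan w → InSpan w′ → InSpan (λ j → w j - w′ j)
  span-- {w} {w′} p q = span-cong (λ j → cong (_+_ (w j)) (ℤP.-1*i≡-i (w′ j))) (span-+ p (span-scale -1ℤ q))

  span-sumL : ∀ {B : Set} (M : List B) (f : B → J → ℤ) → (∀ b → InSpan (f b)) →
              InSpan (λ j → sumL M (λ b → f b j))
  span-sumL []      f p = span-zero
  span-sumL (b ∷ M) f p = span-+ (p b) (span-sumL M f p)

-- v lies in the span of the δ_i and the x_i with A i exactly when v̄ ∈ ⟨x̄_i : A i⟩.

sandpileGenerator : ∀ {d h} → (V d h → Bool) → V d h ⊎ V d h → V d h → ℤ
sandpileGenerator A (inj₁ i) j = [ A i ] * x i j
sandpileGenerator A (inj₂ i) j = δ i j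

sandpileGenerators : ∀ d h → List (V d h ⊎ V d h)
sandpileGenerators d h = map inj₁ (allV d h) ++ map inj₂ (allV d h)

module SandpileSpan {d h : ℕ} (A : V d h → Bool) where

  open LinearSpan (sandpileGenerators d h) (sandpileGenerator A) public

  combination-split : ∀ a j → combination a j ≡
    sumV d h (λ i → [ A i ] * (a (inj₁ i) * x i j)) + sumV d h (λ i → a (inj₂ i) * δ i j)
  combination-split a j = begin
    combination a j
      ≡⟨ sumL-++ (map inj₁ (allV d h)) (map inj₂ (allV d h)) term ⟩
    sumL (map inj₁ (allV d h)) term + sumL (map inj₂ (allV d h)) term
      ≡⟨ cong₂ _+_ (sumL-map inj₁ (allV d h) term) (sumL-map inj₂ (allV d h) term) ⟩
    sumV d h (λ i → a (inj₁ i) * ([ A i ] * x i j)) + sumV d h (λ i → a (inj₂ i) * δ i j)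
      ≡⟨ cong (_+ sumV d h (λ i → a (inj₂ i) * δ i j))
              (sumL-cong (allV d h) (λ i → x*yz≡y*xz (a (inj₁ i)) [ A i ] (x i j))) ⟩
    sumV d h (λ i → [ A i ] * (a (inj₁ i) * x i j)) + sumV d h (λ i → a (inj₂ i) * δ i j)
      ∎
    where
    term : V d h ⊎ V d h → ℤ
    term k = a k * sandpileGenerator A k j

  sumV-zero : sumV d h (λ _ → 0ℤ) ≡ 0ℤ
  sumV-zero = sumL-zero (allV d h)

  sumV-indicatorˡ : ∀ i (g : V d h → ℤ) → sumV d h (λ k → [ eqV k i ] * g k) ≡ g i
  sumV-indicatorˡ i g =
    trans (sumL-cong (allV d h) (λ k → ℤP.*-comm [ eqV k i ] (g k))) (sumV-indicator d h i g)

  basis∈span : ∀ i → A i ≡ true → InSpan (x i)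
  basis∈span i Ai = coefficient , λ j → sym (begin
    combination coefficient j
      ≡⟨ combination-split coefficient j ⟩
    sumV d h (λ k → [ A k ] * ([ eqV k i ] * x k j)) + sumV d h (λ k → 0ℤ * δ k j)
      ≡⟨ cong₂ _+_ (sumL-cong (allV d h) (λ k → x*yz≡y*xz [ A k ] [ eqV k i ] (x k j)))
                   (trans (sumL-cong (allV d h) (λ k → ℤP.*-zeroˡ (δ k j))) sumV-zero) ⟩
    sumV d h (λ k → [ eqV k i ] * ([ A k ] * x k j)) + 0ℤ
      ≡⟨ ℤP.+-identityʳ _ ⟩
    sumV d h (λ k → [ eqV k i ] * ([ A k ] * x k j))
      ≡⟨ sumV-indicatorˡ i (λ k → [ A k ] * x k j) ⟩
    [ A i ] * x i j
      ≡⟨ cong (λ b → [ b ] * x i j) Ai ⟩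
    + 1 * x i j
      ≡⟨ ℤP.*-identityˡ (x i j) ⟩
    x i j
      ∎)
    where
    coefficient : V d h ⊎ V d h → ℤ
    coefficient (inj₁ k) = [ eqV k i ]
    coefficient (inj₂ k) = 0ℤ

  δ∈span : ∀ i → InSpan (δ i)
  δ∈span i = coefficient , λ j → sym (begin
    combination coefficient j
      ≡⟨ combination-split coefficient j ⟩
    sumV d h (λ k → [ A k ] * (0ℤ * x k j)) + sumV d h (λ k → [ eqV k i ] * δ k j)
      ≡⟨ cong (_+ sumV d h (λ k → [ eqV k i ] * δ k j))
              (trans (sumL-cong (allV d h) (λ k → trans (cong ([ A k ] *_) (ℤP.*-zeroˡ (x k j))) (ℤP.*-zeroʳ [ A k ])))
                     sumV-zero) ⟩
    0ℤ + sumV d h (λ k → [ eqV k i ] * δ k j)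
      ≡⟨ ℤP.+-identityˡ _ ⟩
    sumV d h (λ k → [ eqV k i ] * δ k j)
      ≡⟨ sumV-indicatorˡ i (λ k → δ k j) ⟩
    δ i j
      ∎)
    where
    coefficient : V d h ⊎ V d h → ℤ
    coefficient (inj₁ k) = 0ℤ
    coefficient (inj₂ k) = [ eqV k i ]

  generates-if-basis∈span : (∀ i → InSpan (x i)) → Generates d h A
  generates-if-basis∈span basis v = a ∘ inj₁ , a ∘ inj₂ , λ j → begin
    v j - fromA j                          ≡⟨ cong (_- fromA j) (trans (proj₂ v∈span j) (combination-split a j)) ⟩
    (fromA j + fromLattice j) - fromA j    ≡⟨ cancel (fromA j) (fromLattice j) ⟩
    fromLattice j                          ∎
    where
    v∈span : InSpan v
    v∈span = span-cong (λ j → sumV-indicator d h j v)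
                       (span-sumL (allV d h) (λ k j → v k * x k j) (λ k → span-scale (v k) (basis k)))
    a : V d h ⊎ V d h → ℤ
    a = proj₁ v∈span
    fromA fromLattice : V d h → ℤ
    fromA       j = sumV d h (λ i → [ A i ] * (a (inj₁ i) * x i j))
    fromLattice j = sumV d h (λ i → a (inj₂ i) * δ i j)
    cancel : ∀ p q → (p + q) - p ≡ q
    cancel = solve-∀

module Toppling {d h : ℕ} (A : V d h → Bool) where

  open SandpileSpan A

  xVtx xParent xChildren topple : ∀ {n} → Vtx d n → V d h → ℤ
  xVtx      u j = [ eqVtx u (proj₂ j) ]
  xParent   u j = [ isParentVtx (proj₂ j) u ]
  xChildren u j = [ isParentVtx u (proj₂ j) ]
  topple    u j = + d * xVtx u j - xParent u j - xChildren u j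

  xParent-child : ∀ {n} (u : Vtx d n) b j → xParent (child u b) j ≡ xVtx u j
  xParent-child u b j = cong [_] (eqVtx-sym (proj₂ j) u)

  xChildren-sum : ∀ {n} (u : Vtx d n) j → xChildren u j ≡ sumL (allFinL (arity d n)) (λ b → xVtx (child u b) j)
  xChildren-sum u j = isParentVtx-sum u (proj₂ j)

  xChildren-leaf : ∀ {n} (u : Vtx d n) → h ≤ n → ∀ j → xChildren u j ≡ 0ℤ
  xChildren-leaf u h≤n j =
    cong [_] (isParentVtx-shallower u (proj₂ j) (ℕP.≤-trans (depth≤h j) h≤n))

  depth-embed : ∀ {n} (n≤h : n ≤ h) → n ≡ toℕ (fromℕ< (s≤s n≤h))
  depth-embed n≤h = sym (FinP.toℕ-fromℕ< (s≤s n≤h))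

  embed : ∀ {n} → n ≤ h → Vtx d n → V d h
  embed n≤h u = fromℕ< (s≤s n≤h) , subst (Vtx d) (depth-embed n≤h) u

  subst-Vtx-invisible : ∀ {B : Set} {n n′} (f : ∀ {k} → Vtx d k → B) (e : n ≡ n′) (u : Vtx d n) →
                        f (subst (Vtx d) e u) ≡ f u
  subst-Vtx-invisible f refl u = refl

  x-embed : ∀ {n} (n≤h : n ≤ h) (u : Vtx d n) j → x (embed n≤h u) j ≡ xVtx u j
  x-embed n≤h u j = cong [_] (subst-Vtx-invisible (λ v → eqVtx v (proj₂ j)) (depth-embed n≤h) u)

  δ-embed : ∀ {n} (n≤h : n ≤ h) (u : Vtx d n) j → δ (embed n≤h u) j ≡ topple u j
  δ-embed n≤h u j
    rewrite subst-Vtx-invisible (λ v → eqVtx v (proj₂ j)) (depth-embed n≤h) u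
          | subst-Vtx-invisible (λ v → isParentVtx (proj₂ j) v) (depth-embed n≤h) u
          | subst-Vtx-invisible (λ v → isParentVtx v (proj₂ j)) (depth-embed n≤h) u
          = refl

  xVtx∈span : ∀ {n} (n≤h : n ≤ h) (u : Vtx d n) → A (embed n≤h u) ≡ true → InSpan (xVtx u)
  xVtx∈span n≤h u Au = span-cong (x-embed n≤h u) (basis∈span (embed n≤h u) Au)

  topple∈span : ∀ {n} (n≤h : n ≤ h) (u : Vtx d n) → InSpan (topple u)
  topple∈span n≤h u = span-cong (δ-embed n≤h u) (δ∈span (embed n≤h u))

  parent∈span : ∀ {n} (u : Vtx d n) → n ≤ h → InSpan (xVtx u) → InSpan (xChildren u) → InSpan (xParent u)
  parent∈span u n≤h xu xc = span-cong (λ j → solveParent (+ d) (xVtx u j) (xParent u j) (xChildren u j))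
    (span-- (span-- (span-scale (+ d) xu) xc) (topple∈span n≤h u))
    where
    solveParent : ∀ D X P C → D * X - C - (D * X - P - C) ≡ P
    solveParent = solve-∀

  child∈span : ∀ {n} (v : Vtx d n) (c₀ : Fin (arity d n)) → suc n ≤ h →
               InSpan (xVtx v) → InSpan (xParent v) →
               (∀ c → (toℕ c ≡ᵇ toℕ c₀) ≡ false → InSpan (xVtx (child v c))) →
               InSpan (xVtx (child v c₀))
  child∈span {n} v c₀ n<h xv xp siblings = span-cong solveChild
    (span-- (span-- (span-- (span-scale (+ d) xv) xp) others) (topple∈span (ℕP.<⇒≤ n<h) v))
    where
    other : Fin (arity d n) → V d h → ℤ
    other c j = [ not (toℕ c ≡ᵇ toℕ c₀) ] * xVtx (child v c) j
    rest : V d h → ℤ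
    rest j = sumL (allFinL (arity d n)) (λ c → other c j)
    others : InSpan rest
    others = span-sumL (allFinL (arity d n)) other otherOne
      where
      otherOne : ∀ c → InSpan (other c)
      otherOne c with toℕ c ≡ᵇ toℕ c₀ in c=ᵇc₀
      ... | true  = span-cong (λ j → sym (ℤP.*-zeroˡ (xVtx (child v c) j))) span-zero
      ... | false = span-scale (+ 1) (siblings c c=ᵇc₀)
    xChildren-split : ∀ j → xChildren v j ≡ xVtx (child v c₀) j + rest j
    xChildren-split j =
      trans (xChildren-sum v j) (sumL-allFin-split (arity d n) (λ c → xVtx (child v c) j) c₀)
    rearrange : ∀ D X P M R → D * X - P - R - (D * X - P - (M + R)) ≡ M
    rearrange = solve-∀
    solveChild : ∀ j → + d * xVtx v j - xParent v j - rest j - topple v j ≡ xVtx (child v c₀) j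
    solveChild j = trans
      (cong (λ C → + d * xVtx v j - xParent v j - rest j - (+ d * xVtx v j - xParent v j - C)) (xChildren-split j))
      (rearrange (+ d) (xVtx v j) (xParent v j) (xVtx (child v c₀) j) (rest j))

module ChosenChildren (d h : ℕ) (m : Choice d) where

  open SandpileSpan (inF {d} {h} m)
  open Toppling (inF {d} {h} m)

  inFVtx⇒xVtx∈span : ∀ {n} (n≤h : n ≤ h) (u : Vtx d n) → inFVtx h m u ≡ true → InSpan (xVtx u)
  inFVtx⇒xVtx∈span n≤h u u∈F = xVtx∈span n≤h u (trans (subst-Vtx-invisible (inFVtx h m) (depth-embed n≤h) u) u∈F)

  unchosenChild∈span : ∀ t {k} (u : Vtx d k) b → k +ℕ suc (t +ℕ t) ≡ h → (toℕ b ≡ᵇ toℕ (m u)) ≡ false →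
                       InSpan (xVtx (child u b))
  unchosenChild∈span t {k} u b k+r≡h b≢m =
    inFVtx⇒xVtx∈span k<h (child u b) (subst (λ H → inFVtx H m (child u b) ≡ true) k+r≡h child∈F)
    where
    k<h : suc k ≤ h
    k<h = subst (suc k ≤_) k+r≡h (ℕP.m<m+n k ℕP.0<1+n)
    child∈F : inFVtx (k +ℕ suc (t +ℕ t)) m (child u b) ≡ true
    child∈F rewrite oddHeight-depthCondition k t | b≢m = refl

  oddHeight∈span : 3 ≤ d → ∀ t {k} (u : Vtx d k) → k +ℕ suc (t +ℕ t) ≡ h → InSpan (xVtx u)
  oddHeight∈span d≥3 t {k} u k+r≡h =
    span-cong (xParent-child u b) (parent∈span a k<h (unchosenChild∈span t u b k+r≡h b≢m) (xChildren-a t k+r≡h))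
    where
    b : Fin (arity d k)
    b = proj₁ (anotherFin (arity≥2 d≥3 k) (m u))
    b≢m : (toℕ b ≡ᵇ toℕ (m u)) ≡ false
    b≢m = proj₂ (anotherFin (arity≥2 d≥3 k) (m u))
    a : Vtx d (suc k)
    a = child u b
    k<h : suc k ≤ h
    k<h = subst (suc k ≤_) k+r≡h (ℕP.m<m+n k ℕP.0<1+n)
    twoLevelsDown : ∀ s → suc (suc k) +ℕ suc (s +ℕ s) ≡ k +ℕ suc (suc s +ℕ suc s)
    twoLevelsDown = ℕ-solve-∀
    xChildren-a : ∀ s → k +ℕ suc (s +ℕ s) ≡ h → InSpan (xChildren a)
    xChildren-a zero    k+1≡h =
      span-cong (λ j → sym (xChildren-leaf a (ℕP.≤-reflexive (trans (sym k+1≡h) (ℕP.+-comm k 1))) j)) span-zero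
    xChildren-a (suc s) k+r≡h = span-cong (λ j → sym (xChildren-sum a j))
      (span-sumL (allFinL (arity d (suc k))) (λ c → xVtx (child a c))
                 (λ c → oddHeight∈span d≥3 s (child a c) (trans (twoLevelsDown s) k+r≡h)))

  vertex∈span : 3 ≤ d → ∀ {k} (v : Vtx d k) → k ≤ h → InSpan (xVtx v) × InSpan (xParent v)
  vertex∈span d≥3 root _ = byParity (even⊎odd h) , span-zero
    where
    byParity : (∃ λ t → h ≡ t +ℕ t) ⊎ (∃ λ t → h ≡ suc (t +ℕ t)) → InSpan (xVtx root)
    byParity (inj₁ (t , h≡)) = inFVtx⇒xVtx∈span z≤n root (trans (cong isEven h≡) (isEven-double t))
    byParity (inj₂ (t , h≡)) = oddHeight∈span d≥3 t root (sym h≡)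
  vertex∈span d≥3 (child {k} v b) k<h with ℕP.m≤n⇒∃[o]m+o≡n k<h | vertex∈span d≥3 v (ℕP.<⇒≤ k<h)
  ... | o , k+o≡h | xv , xpv = byParity (even⊎odd o) , span-cong (λ j → sym (xParent-child v b j)) xv
    where
    evenHeight : ∀ t → k +ℕ suc (t +ℕ t) ≡ h → InSpan (xVtx (child v b))
    evenHeight t k+r≡h with toℕ b ≡ᵇ toℕ (m v) in b=ᵇm
    ... | false = unchosenChild∈span t v b k+r≡h b=ᵇm
    ... | true  = subst (λ c → InSpan (xVtx (child v c))) (sym (toℕ-≡ᵇ⇒≡ b (m v) b=ᵇm))
                        (child∈span v (m v) k<h xv xpv (λ c → unchosenChild∈span t v c k+r≡h))
    byParity : (∃ λ t → o ≡ t +ℕ t) ⊎ (∃ λ t → o ≡ suc (t +ℕ t)) → InSpan (xVtx (child v b))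
    byParity (inj₁ (t , refl)) = evenHeight t (trans (ℕP.+-suc k (t +ℕ t)) k+o≡h)
    byParity (inj₂ (t , refl)) = oddHeight∈span d≥3 t (child v b) k+o≡h

lemma6p4 : (d h : ℕ) → 3 ≤ d → 1 ≤ h → (m : Choice d) → Generates d h (inF m)
lemma6p4 d h d≥3 _ m =
  SandpileSpan.generates-if-basis∈span (inF m) (λ i → proj₁ (vertex∈span d≥3 (proj₂ i) (depth≤h i)))
  where open ChosenChildren d h m
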